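{- For integers $n\geq 1$, $0\leq t\leq n$ define the polynomial in $x$ \begin{align*} \psi^{(n,t)}(x)=&(n+1)^2(n-x)^3(n-x+1)^3(2n-2t+2x+1)(2n-2t+2x-1)\\ &+(n+1)^2(n-t+x)^3(n-t+x+1)^3(2n-2x-1)(2n-2x+1)\\ &-2n^2(n-x+1)^3(n-t+x+1)^3(2n-2x-1)(2n-2t+2x-1). \end{align*} Then for every integer $n\geq 2$ and every integer $0\leq t\leq n-1$ there exists an index $k'$ (depending on $n,t$) such that $\psi^{(n,t)}(k)\geq 0$ for all integers $1\leq k\leq k'$ and $\psi^{(n,t)}(k)\leq 0$ for all integers $k'<k\leq t/2$. -}

module Defs where

open import Data.Integer using (ℤ; +_; _+_; _-_; _*_; _^_)

ψ : ℤ → ℤ → ℤ → ℤ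
ψ n t x =
    (n + + 1) ^ 2 * (n - x) ^ 3 * (n - x + + 1) ^ 3
      * (+ 2 * n - + 2 * t + + 2 * x + + 1) * (+ 2 * n - + 2 * t + + 2 * x - + 1)
  + (n + + 1) ^ 2 * (n - t + x) ^ 3 * (n - t + x + + 1) ^ 3
      * (+ 2 * n - + 2 * x - + 1) * (+ 2 * n - + 2 * x + + 1)
  - + 2 * n ^ 2 * (n - x + + 1) ^ 3 * (n - t + x + + 1) ^ 3
      * (+ 2 * n - + 2 * x - + 1) * (+ 2 * n - + 2 * t + + 2 * x - + 1)

module Submission where

-- For k ≥ 0 with 2k + 2 ≤ t put  p = n - t + k - 1 ≥ 0  and
-- e = t - 2k - 2 ≥ 0.  Written in p and e the eight linear factors of ψ
-- give   ψ(k) = (n+1)² σ(p,e) - 2n² β(p,e)   for explicit polynomials σ, β,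
-- and passing from k to k + 1 replaces (p, e) by (p + 1, e - 2).  The cross
-- difference  σ(p,e) β(p+1,e-2) - σ(p+1,e-2) β(p,e)  has only nonnegative
-- coefficients and β(p,e) ≥ 1, so ψ(k) ≤ 0 forces ψ(k+1) ≤ 0.  A sequence in
-- which "≤ 0" persists changes sign at most once, and k′ is the last index
-- before the change.

open import Defs
open import Data.Integer
  using (ℤ; +_; _+_; _-_; _*_; -_; _^_; _≤_; _<_; +≤+; +<+; _≤?_; nonNegative; positive)
  renaming (suc to sucℤ)
import Data.Integer.Properties as ℤP
open import Data.Integer.Tactic.RingSolver using (solve-∀)
open import Data.Nat as ℕ using (ℕ; zero; suc; z≤n; s≤s)
import Data.Nat.Properties as ℕP
open import Data.List using (List; []; _∷_; map)
open import Data.List.Relation.Unary.All as All using (All; []; _∷_; all?)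
open import Data.Product using (∃-syntax; _×_; _,_)
open import Data.Sum using (_⊎_; inj₁; inj₂)
open import Data.Empty using (⊥-elim)
open import Function using (id)
open import Relation.Nullary using (yes; no)
open import Relation.Nullary.Decidable using (True; toWitness)
open import Relation.Binary.PropositionalEquality

nonneg-* : ∀ {a b} → + 0 ≤ a → + 0 ≤ b → + 0 ≤ a * b
nonneg-* {a} {b} 0≤a 0≤b = ℤP.*-monoʳ-≤-nonNeg b ⦃ nonNegative 0≤b ⦄ 0≤a

horner : {C : Set} → (C → ℤ) → ℤ → List C → ℤ
horner ev x []      = + 0
horner ev x (c ∷ p) = ev c + x * horner ev x p

horner-nonneg : {C : Set} (ev : C → ℤ) {x : ℤ} → + 0 ≤ x →
                {p : List C} → All (λ c → + 0 ≤ ev c) p → + 0 ≤ horner ev x p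
horner-nonneg ev 0≤x []         = ℤP.≤-refl
horner-nonneg ev 0≤x (0≤c ∷ cs) = ℤP.+-mono-≤ 0≤c (nonneg-* 0≤x (horner-nonneg ev 0≤x cs))

module DensePoly {C : Set} (0C : C) (_+C_ _*C_ : C → C → C) (-C_ : C → C) where
  infixl 6 _+ₚ_
  infixl 7 _*ₚ_

  _+ₚ_ : List C → List C → List C
  []      +ₚ q       = q
  (a ∷ p) +ₚ []      = a ∷ p
  (a ∷ p) +ₚ (b ∷ q) = (a +C b) ∷ (p +ₚ q)

  -ₚ_ : List C → List C
  -ₚ_ = map -C_

  _*ₚ_ : List C → List C → List C
  []      *ₚ q = []
  (c ∷ p) *ₚ q = map (c *C_) q +ₚ (0C ∷ p *ₚ q)

module HornerHomomorphism
  {C : Set} (0C : C) (_+C_ _*C_ : C → C → C) (-C_ : C → C) (ev : C → ℤ)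
  (ev-0 : ev 0C ≡ + 0)
  (ev-+ : ∀ a b → ev (a +C b) ≡ ev a + ev b)
  (ev-* : ∀ a b → ev (a *C b) ≡ ev a * ev b)
  (ev-- : ∀ a → ev (-C a) ≡ - ev a)
  (x : ℤ) where

  open DensePoly 0C _+C_ _*C_ -C_

  private
    ⟪_⟫ : List C → ℤ
    ⟪_⟫ = horner ev x

    interchange : ∀ a b x p q → (a + b) + x * (p + q) ≡ (a + x * p) + (b + x * q)
    interchange = solve-∀
    neg-horner : ∀ a x p → - a + x * - p ≡ - (a + x * p)
    neg-horner = solve-∀
    scale-horner : ∀ c a x p → c * a + x * (c * p) ≡ c * (a + x * p)
    scale-horner = solve-∀
    mul-horner : ∀ c q x p → c * q + (+ 0 + x * (p * q)) ≡ (c + x * p) * q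
    mul-horner = solve-∀

  horner-+ : ∀ p q → ⟪ p +ₚ q ⟫ ≡ ⟪ p ⟫ + ⟪ q ⟫
  horner-+ []      q       = sym (ℤP.+-identityˡ _)
  horner-+ (a ∷ p) []      = sym (ℤP.+-identityʳ _)
  horner-+ (a ∷ p) (b ∷ q) =
    trans (cong₂ (λ u v → u + x * v) (ev-+ a b) (horner-+ p q))
          (interchange (ev a) (ev b) x ⟪ p ⟫ ⟪ q ⟫)

  horner-- : ∀ p → ⟪ -ₚ p ⟫ ≡ - ⟪ p ⟫
  horner-- []      = refl
  horner-- (a ∷ p) =
    trans (cong₂ (λ u v → u + x * v) (ev-- a) (horner-- p)) (neg-horner (ev a) x ⟪ p ⟫)

  horner-scale : ∀ c p → ⟪ map (c *C_) p ⟫ ≡ ev c * ⟪ p ⟫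
  horner-scale c []      = sym (ℤP.*-zeroʳ (ev c))
  horner-scale c (a ∷ p) =
    trans (cong₂ (λ u v → u + x * v) (ev-* c a) (horner-scale c p))
          (scale-horner (ev c) (ev a) x ⟪ p ⟫)

  horner-* : ∀ p q → ⟪ p *ₚ q ⟫ ≡ ⟪ p ⟫ * ⟪ q ⟫
  horner-* []      q = sym (ℤP.*-zeroˡ ⟪ q ⟫)
  horner-* (c ∷ p) q =
    trans (horner-+ (map (c *C_) q) (0C ∷ p *ₚ q))
    (trans (cong₂ (λ u v → u + (v + x * ⟪ p *ₚ q ⟫)) (horner-scale c q) ev-0)
    (trans (cong (λ v → ev c * ⟪ q ⟫ + (+ 0 + x * v)) (horner-* p q))
           (mul-horner (ev c) ⟪ q ⟫ x ⟪ p ⟫)))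

module ℤ[y]    = DensePoly (+ 0) _+_ _*_ -_
module ℤ[y][x] = DensePoly [] ℤ[y]._+ₚ_ ℤ[y]._*ₚ_ ℤ[y].-ₚ_

module Hom[y] (y : ℤ) =
  HornerHomomorphism (+ 0) _+_ _*_ -_ id refl (λ _ _ → refl) (λ _ _ → refl) (λ _ → refl) y

module Hom[y][x] (y x : ℤ) =
  HornerHomomorphism [] ℤ[y]._+ₚ_ ℤ[y]._*ₚ_ ℤ[y].-ₚ_ (horner id y)
    refl (Hom[y].horner-+ y) (Hom[y].horner-* y) (Hom[y].horner-- y) x

NF : Set
NF = List (List ℤ)

evalNF : ℤ → ℤ → NF → ℤ
evalNF x y = horner (horner id y) x

data Expr : Set where
  X Y     : Expr
  K       : ℤ → Expr
  _⊕_ _⊗_ : Expr → Expr → Expr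
  ⊝_      : Expr → Expr
  _↑_     : Expr → ℕ → Expr

infixl 6 _⊕_
infixl 7 _⊗_
infix  8 ⊝_
infixl 9 _↑_

⟦_⟧ : Expr → ℤ → ℤ → ℤ
⟦ X     ⟧ x y = x
⟦ Y     ⟧ x y = y
⟦ K c   ⟧ x y = c
⟦ a ⊕ b ⟧ x y = ⟦ a ⟧ x y + ⟦ b ⟧ x y
⟦ a ⊗ b ⟧ x y = ⟦ a ⟧ x y * ⟦ b ⟧ x y
⟦ ⊝ a   ⟧ x y = - ⟦ a ⟧ x y
⟦ a ↑ m ⟧ x y = ⟦ a ⟧ x y ^ m

constNF : ℤ → NF
constNF c = (c ∷ []) ∷ []

powerNF : NF → ℕ → NF
powerNF p zero    = constNF (+ 1)
powerNF p (suc m) = p ℤ[y][x].*ₚ powerNF p m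

norm : Expr → NF
norm X       = [] ∷ (+ 1 ∷ []) ∷ []
norm Y       = (+ 0 ∷ + 1 ∷ []) ∷ []
norm (K c)   = constNF c
norm (a ⊕ b) = norm a ℤ[y][x].+ₚ norm b
norm (a ⊗ b) = norm a ℤ[y][x].*ₚ norm b
norm (⊝ a)   = ℤ[y][x].-ₚ norm a
norm (a ↑ m) = powerNF (norm a) m

evalNF-const : ∀ c x y → evalNF x y (constNF c) ≡ c
evalNF-const c x y = lemma c x y
  where lemma : ∀ c x y → (c + y * + 0) + x * + 0 ≡ c
        lemma = solve-∀

evalNF-power : ∀ p m x y → evalNF x y (powerNF p m) ≡ evalNF x y p ^ m
evalNF-power p zero    x y = evalNF-const (+ 1) x y
evalNF-power p (suc m) x y =
  trans (Hom[y][x].horner-* y x p (powerNF p m)) (cong (evalNF x y p *_) (evalNF-power p m x y))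

norm-sound : ∀ e x y → evalNF x y (norm e) ≡ ⟦ e ⟧ x y
norm-sound X x y = lemma x y
  where lemma : ∀ x y → + 0 + x * ((+ 1 + y * + 0) + x * + 0) ≡ x
        lemma = solve-∀
norm-sound Y x y = lemma x y
  where lemma : ∀ x y → (+ 0 + y * (+ 1 + y * + 0)) + x * + 0 ≡ y
        lemma = solve-∀
norm-sound (K c)   x y = evalNF-const c x y
norm-sound (a ⊕ b) x y =
  trans (Hom[y][x].horner-+ y x (norm a) (norm b)) (cong₂ _+_ (norm-sound a x y) (norm-sound b x y))
norm-sound (a ⊗ b) x y =
  trans (Hom[y][x].horner-* y x (norm a) (norm b)) (cong₂ _*_ (norm-sound a x y) (norm-sound b x y))
norm-sound (⊝ a)   x y = trans (Hom[y][x].horner-- y x (norm a)) (cong -_ (norm-sound a x y))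
norm-sound (a ↑ m) x y = trans (evalNF-power (norm a) m x y) (cong (_^ m) (norm-sound a x y))

NonnegCoefficients : Expr → Set
NonnegCoefficients e = True (all? (all? (+ 0 ≤?_)) (norm e))

nonneg-certificate : ∀ e {x y} → + 0 ≤ x → + 0 ≤ y → NonnegCoefficients e → + 0 ≤ ⟦ e ⟧ x y
nonneg-certificate e {x} {y} 0≤x 0≤y certificate =
  subst (+ 0 ≤_) (norm-sound e x y)
    (horner-nonneg (horner id y) 0≤x (All.map (horner-nonneg id 0≤y) (toWitness certificate)))

sign-persists : ∀ {N c S₀ S₁ B₀ B₁} → + 0 ≤ N → + 0 < B₀ → + 0 ≤ B₁ →
                S₁ * B₀ ≤ S₀ * B₁ → N * S₀ - c * B₀ ≤ + 0 → N * S₁ - c * B₁ ≤ + 0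
sign-persists {N} {c} {S₀} {S₁} {B₀} {B₁} 0≤N 0<B₀ 0≤B₁ cross before =
  ℤP.i≤j⇒i-j≤0 (ℤP.*-cancelˡ-≤-pos (N * S₁) (c * B₁) B₀ ⦃ positive 0<B₀ ⦄ scaled)
  where
  open ℤP.≤-Reasoning
  NS₀≤cB₀ : N * S₀ ≤ c * B₀
  NS₀≤cB₀ = ℤP.i-j≤0⇒i≤j before
  regroup₁ : ∀ B₀ N S₁ → B₀ * (N * S₁) ≡ N * (S₁ * B₀)
  regroup₁ = solve-∀
  regroup₂ : ∀ N S₀ B₁ → N * (S₀ * B₁) ≡ B₁ * (N * S₀)
  regroup₂ = solve-∀
  regroup₃ : ∀ B₁ c B₀ → B₁ * (c * B₀) ≡ B₀ * (c * B₁)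
  regroup₃ = solve-∀
  scaled : B₀ * (N * S₁) ≤ B₀ * (c * B₁)
  scaled = begin
    B₀ * (N * S₁) ≡⟨ regroup₁ B₀ N S₁ ⟩
    N * (S₁ * B₀) ≤⟨ ℤP.*-monoˡ-≤-nonNeg N ⦃ nonNegative 0≤N ⦄ cross ⟩
    N * (S₀ * B₁) ≡⟨ regroup₂ N S₀ B₁ ⟩
    B₁ * (N * S₀) ≤⟨ ℤP.*-monoˡ-≤-nonNeg B₁ ⦃ nonNegative 0≤B₁ ⦄ NS₀≤cB₀ ⟩
    B₁ * (c * B₀) ≡⟨ regroup₃ B₁ c B₀ ⟩
    B₀ * (c * B₁) ∎

record Factors (A : Set) : Set where
  constructor factors
  field a a′ b b′ c c′ d d′ : A

Ψ : ℤ → ℤ → Factors ℤ → ℤ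
Ψ N M (factors a a′ b b′ c c′ d d′) =
  N * a ^ 3 * a′ ^ 3 * c * c′ + N * b ^ 3 * b′ ^ 3 * d * d′ - + 2 * M * a′ ^ 3 * b′ ^ 3 * d * c′

ψ-factors : ℤ → ℤ → ℤ → Factors ℤ
ψ-factors n t x =
  factors (n - x) (n - x + + 1) (n - t + x) (n - t + x + + 1)
          (+ 2 * n - + 2 * t + + 2 * x + + 1) (+ 2 * n - + 2 * t + + 2 * x - + 1)
          (+ 2 * n - + 2 * x - + 1) (+ 2 * n - + 2 * x + + 1)

factors-cong : ∀ {a₁ a₂ a′₁ a′₂ b₁ b₂ b′₁ b′₂ c₁ c₂ c′₁ c′₂ d₁ d₂ d′₁ d′₂ : ℤ} →
  a₁ ≡ a₂ → a′₁ ≡ a′₂ → b₁ ≡ b₂ → b′₁ ≡ b′₂ → c₁ ≡ c₂ → c′₁ ≡ c′₂ → d₁ ≡ d₂ → d′₁ ≡ d′₂ →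
  factors a₁ a′₁ b₁ b′₁ c₁ c′₁ d₁ d′₁ ≡ factors a₂ a′₂ b₂ b′₂ c₂ c′₂ d₂ d′₂
factors-cong refl refl refl refl refl refl refl refl = refl

sumPart crossPart : Factors Expr → Expr
sumPart   (factors a a′ b b′ c c′ d d′) = a ↑ 3 ⊗ a′ ↑ 3 ⊗ c ⊗ c′ ⊕ b ↑ 3 ⊗ b′ ↑ 3 ⊗ d ⊗ d′
crossPart (factors a a′ b b′ c c′ d d′) = a′ ↑ 3 ⊗ b′ ↑ 3 ⊗ d ⊗ c′

evalFactors : Factors Expr → ℤ → ℤ → Factors ℤ
evalFactors (factors a a′ b b′ c c′ d d′) x y =
  factors (⟦ a ⟧ x y) (⟦ a′ ⟧ x y) (⟦ b ⟧ x y) (⟦ b′ ⟧ x y)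
          (⟦ c ⟧ x y) (⟦ c′ ⟧ x y) (⟦ d ⟧ x y) (⟦ d′ ⟧ x y)

Ψ-regroup : ∀ N M F x y →
  Ψ N M (evalFactors F x y) ≡ N * ⟦ sumPart F ⟧ x y - + 2 * M * ⟦ crossPart F ⟧ x y
Ψ-regroup N M (factors a a′ b b′ c c′ d d′) x y =
  regroup N M (⟦ a ⟧ x y) (⟦ a′ ⟧ x y) (⟦ b ⟧ x y) (⟦ b′ ⟧ x y)
              (⟦ c ⟧ x y) (⟦ c′ ⟧ x y) (⟦ d ⟧ x y) (⟦ d′ ⟧ x y)
  where
  -- the ring solver does not handle _^_ on ℤ, so the cubes appear unfolded:
  -- x ^ 3 is by definition x * (x * (x * + 1))
  regroup : ∀ N M a a′ b b′ c c′ d d′ →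
      N * (a * (a * (a * + 1))) * (a′ * (a′ * (a′ * + 1))) * c * c′
    + N * (b * (b * (b * + 1))) * (b′ * (b′ * (b′ * + 1))) * d * d′
    - + 2 * M * (a′ * (a′ * (a′ * + 1))) * (b′ * (b′ * (b′ * + 1))) * d * c′
    ≡ N * ((a * (a * (a * + 1))) * (a′ * (a′ * (a′ * + 1))) * c * c′
           + (b * (b * (b * + 1))) * (b′ * (b′ * (b′ * + 1))) * d * d′)
      - + 2 * M * ((a′ * (a′ * (a′ * + 1))) * (b′ * (b′ * (b′ * + 1))) * d * c′)
  regroup = solve-∀

-- The factors of ψ(k) as expressions in p = n - t + k - 1 (variable X) and
-- e = t - 2k - 2 (variable Y); all have nonnegative coefficients.
coordinateFactors : Expr → Expr → Factors Expr
coordinateFactors p e =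
  factors (p ⊕ K (+ 3) ⊕ e) (p ⊕ K (+ 4) ⊕ e) (p ⊕ K (+ 1)) (p ⊕ K (+ 2))
          (K (+ 2) ⊗ p ⊕ K (+ 3)) (K (+ 2) ⊗ p ⊕ K (+ 1))
          (K (+ 2) ⊗ p ⊕ K (+ 2) ⊗ e ⊕ K (+ 5)) (K (+ 2) ⊗ p ⊕ K (+ 2) ⊗ e ⊕ K (+ 7))

-- σ, β at (p, e), and σ⁺, β⁺ at the point (p + 1, e - 2) belonging to k + 1.
σ β σ⁺ β⁺ : Expr
σ  = sumPart   (coordinateFactors X Y)
β  = crossPart (coordinateFactors X Y)
σ⁺ = sumPart   (coordinateFactors (X ⊕ K (+ 1)) (Y ⊕ K (- + 2)))
β⁺ = crossPart (coordinateFactors (X ⊕ K (+ 1)) (Y ⊕ K (- + 2)))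

ψ-in-coordinates : ∀ n t k {p e} → p ≡ n - t + k - + 1 → e ≡ t - + 2 * k - + 2 →
  ψ n t k ≡ (n + + 1) ^ 2 * ⟦ σ ⟧ p e - + 2 * n ^ 2 * ⟦ β ⟧ p e
ψ-in-coordinates n t k {p} {e} refl refl =
  trans (cong (Ψ ((n + + 1) ^ 2) (n ^ 2)) factors-in-coordinates)
        (Ψ-regroup ((n + + 1) ^ 2) (n ^ 2) (coordinateFactors X Y) p e)
  where
  factors-in-coordinates : ψ-factors n t k ≡ evalFactors (coordinateFactors X Y) p e
  factors-in-coordinates = factors-cong (ea n t k) (ea′ n t k) (eb n t k) (eb′ n t k)
                                        (ec n t k) (ec′ n t k) (ed n t k) (ed′ n t k)
    where
    ea  : ∀ n t k → n - k ≡ (n - t + k - + 1) + + 3 + (t - + 2 * k - + 2)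
    ea  = solve-∀
    ea′ : ∀ n t k → n - k + + 1 ≡ (n - t + k - + 1) + + 4 + (t - + 2 * k - + 2)
    ea′ = solve-∀
    eb  : ∀ n t k → n - t + k ≡ (n - t + k - + 1) + + 1
    eb  = solve-∀
    eb′ : ∀ n t k → n - t + k + + 1 ≡ (n - t + k - + 1) + + 2
    eb′ = solve-∀
    ec  : ∀ n t k → + 2 * n - + 2 * t + + 2 * k + + 1 ≡ + 2 * (n - t + k - + 1) + + 3
    ec  = solve-∀
    ec′ : ∀ n t k → + 2 * n - + 2 * t + + 2 * k - + 1 ≡ + 2 * (n - t + k - + 1) + + 1
    ec′ = solve-∀
    ed  : ∀ n t k → + 2 * n - + 2 * k - + 1
                  ≡ + 2 * (n - t + k - + 1) + + 2 * (t - + 2 * k - + 2) + + 5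
    ed  = solve-∀
    ed′ : ∀ n t k → + 2 * n - + 2 * k + + 1
                  ≡ + 2 * (n - t + k - + 1) + + 2 * (t - + 2 * k - + 2) + + 7
    ed′ = solve-∀

ψ-next-in-coordinates : ∀ n t k → let p = n - t + k - + 1; e = t - + 2 * k - + 2 in
  ψ n t (sucℤ k) ≡ (n + + 1) ^ 2 * ⟦ σ⁺ ⟧ p e - + 2 * n ^ 2 * ⟦ β⁺ ⟧ p e
ψ-next-in-coordinates n t k = ψ-in-coordinates n t (sucℤ k) (shift-p n t k) (shift-e t k)
  where
  shift-p : ∀ n t k → n - t + k - + 1 + + 1 ≡ n - t + (+ 1 + k) - + 1
  shift-p = solve-∀
  shift-e : ∀ t k → t - + 2 * k - + 2 + - + 2 ≡ t - + 2 * (+ 1 + k) - + 2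
  shift-e = solve-∀

cross-inequality : ∀ {p e} → + 0 ≤ p → + 0 ≤ e →
                   ⟦ σ⁺ ⟧ p e * ⟦ β ⟧ p e ≤ ⟦ σ ⟧ p e * ⟦ β⁺ ⟧ p e
cross-inequality 0≤p 0≤e =
  ℤP.0≤i-j⇒j≤i (nonneg-certificate (σ ⊗ β⁺ ⊕ ⊝ (σ⁺ ⊗ β)) 0≤p 0≤e _)

β-positive : ∀ {p e} → + 0 ≤ p → + 0 ≤ e → + 0 < ⟦ β ⟧ p e
β-positive 0≤p 0≤e =
  ℤP.suc[i]≤j⇒i<j (ℤP.0≤i-j⇒j≤i (nonneg-certificate (β ⊕ ⊝ K (+ 1)) 0≤p 0≤e _))

β⁺-nonneg : ∀ {p e} → + 0 ≤ p → + 0 ≤ e → + 0 ≤ ⟦ β⁺ ⟧ p e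
β⁺-nonneg 0≤p 0≤e = nonneg-certificate β⁺ 0≤p 0≤e _

ψ-persists : ∀ {n t k} → + 0 ≤ n → + 0 ≤ k → t < n → + 2 * sucℤ k ≤ t →
             ψ n t k ≤ + 0 → ψ n t (sucℤ k) ≤ + 0
ψ-persists {n} {t} {k} 0≤n 0≤k t<n 2[k+1]≤t ψk≤0 =
  subst (_≤ + 0) (sym (ψ-next-in-coordinates n t k))
    (sign-persists {N = (n + + 1) ^ 2} {c = + 2 * n ^ 2}
                   {S₀ = ⟦ σ ⟧ p e} {S₁ = ⟦ σ⁺ ⟧ p e} {B₀ = ⟦ β ⟧ p e} {B₁ = ⟦ β⁺ ⟧ p e}
                   0≤N (β-positive 0≤p 0≤e) (β⁺-nonneg 0≤p 0≤e) (cross-inequality 0≤p 0≤e)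
      (subst (_≤ + 0) (ψ-in-coordinates n t k refl refl) ψk≤0))
  where
  p e : ℤ
  p = n - t + k - + 1
  e = t - + 2 * k - + 2
  0≤N : + 0 ≤ (n + + 1) ^ 2
  0≤N = nonneg-certificate ((X ⊕ K (+ 1)) ↑ 2) 0≤n 0≤n _
  p-form : ∀ n t k → n - (+ 1 + t) + k ≡ n - t + k - + 1
  p-form = solve-∀
  e-form : ∀ t k → t - + 2 * (+ 1 + k) ≡ t - + 2 * k - + 2
  e-form = solve-∀
  0≤p : + 0 ≤ p
  0≤p = subst (+ 0 ≤_) (p-form n t k)
              (ℤP.+-mono-≤ (ℤP.i≤j⇒0≤j-i (ℤP.i<j⇒suc[i]≤j t<n)) 0≤k)
  0≤e : + 0 ≤ e
  0≤e = subst (+ 0 ≤_) (e-form t k) (ℤP.i≤j⇒0≤j-i 2[k+1]≤t)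

extend : ∀ {Q R : ℕ → Set} {L} → (∀ k → R k → k ℕ.≤ L → Q k) → Q (suc L) →
         ∀ k → R k → k ℕ.≤ suc L → Q k
extend below top k r k≤1+L with ℕP.m≤n⇒m<n∨m≡n k≤1+L
... | inj₁ (s≤s k≤L) = below k r k≤L
... | inj₂ refl      = top

single-sign-change : ∀ {G B : ℕ → Set} → (∀ j → G j ⊎ B j) → (∀ j → B j → B (suc j)) →
  ∀ L → ∃[ j′ ] ((∀ k → 1 ℕ.≤ k → k ℕ.≤ j′ → G k) × (∀ k → j′ ℕ.< k → k ℕ.≤ L → B k))
single-sign-change good-or-bad persists zero =
  0 , (λ { k 1≤k z≤n → ⊥-elim (ℕP.<⇒≱ 1≤k z≤n) }) , (λ { k 0<k z≤n → ⊥-elim (ℕP.<⇒≱ 0<k z≤n) })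
single-sign-change good-or-bad persists (suc L)
  with single-sign-change good-or-bad persists L | good-or-bad (suc L)
... | j , good , bad | inj₂ b = j , good , extend bad b
... | j , good , bad | inj₁ g with j ℕ.<? L
...   | yes j<L = j , good , extend bad (persists L (bad L j<L ℕP.≤-refl))
...   | no  j≮L = suc L , extend (λ k 1≤k k≤L → good k 1≤k (ℕP.≤-trans k≤L (ℕP.≮⇒≥ j≮L))) g
                        , λ k L<k k≤L → ⊥-elim (ℕP.<⇒≱ L<k k≤L)

half-bound : ∀ k t → + 2 * + k ≤ + t → k ℕ.≤ t
half-bound k t 2k≤t =
  ℕP.≤-trans (ℕP.m≤n*m k 2) (ℤP.drop‿+≤+ (subst (_≤ + t) (sym (ℤP.pos-* 2 k)) 2k≤t))

proposition3p4 : ∀ (n t : ℤ) → + 2 ≤ n → + 0 ≤ t → t < n →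
    ∃[ k′ ] ((∀ (k : ℤ) → + 1 ≤ k → k ≤ k′ → + 0 ≤ ψ n t k)
           × (∀ (k : ℤ) → k′ < k → + 2 * k ≤ t → ψ n t k ≤ + 0))
proposition3p4 (+ n) (+ t) _ _ t<n =
  let (j′ , good , bad) = single-sign-change {G} {B} good-or-bad persists t in
  + j′ , (λ { (+ suc k) (+≤+ (s≤s _)) (+≤+ k≤j′) → good (suc k) (s≤s z≤n) k≤j′ })
       , (λ { (+ k) (+<+ j′<k) 2k≤t → bad k j′<k (half-bound k t 2k≤t) 2k≤t })
  where
  G B : ℕ → Set
  G j = + 0 ≤ ψ (+ n) (+ t) (+ j)
  B j = + 2 * + j ≤ + t → ψ (+ n) (+ t) (+ j) ≤ + 0
  good-or-bad : ∀ j → G j ⊎ B j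
  good-or-bad j with ψ (+ n) (+ t) (+ j) ≤? + 0
  ... | yes ψ≤0 = inj₂ (λ _ → ψ≤0)
  ... | no  ψ≰0 = inj₁ (ℤP.<⇒≤ (ℤP.≰⇒> ψ≰0))
  persists : ∀ j → B j → B (suc j)
  persists j bad 2[j+1]≤t = ψ-persists (+≤+ z≤n) (+≤+ z≤n) t<n 2[j+1]≤t
    (bad (ℤP.≤-trans (ℤP.*-monoˡ-≤-nonNeg (+ 2) (+≤+ (ℕP.n≤1+n j))) 2[j+1]≤t))
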